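{- Let $\mathcal C_n$ be the set of permutations in $\mathfrak S_n$ avoiding $1\text{ - }23$ and $3\text{ - }12$. Label each $\pi\in\mathcal C_n$ by $(\pi_n,n)$. Then $1\in\mathcal C_1$ has label $(1,1)$, and for $\pi\in\mathcal C_n$ with label $(r,n)$ the multiset of labels of its children in $\mathcal C_{n+1}$ is: $(1,n+1),(n+1,n+1)$ if $r=1$; and $(1,n+1),(2,n+1),\dots,(r,n+1)$ if $r>1$.
   Context: $\mathfrak S_n$ is the set of permutations $\pi=\pi_1\cdots\pi_n$ of $\{1,\dots,n\}$. $\pi$ avoids $1\text{ - }23$ if there are no $i<j$ with $\pi_i<\pi_j<\pi_{j+1}$; $\pi$ avoids $3\text{ - }12$ if there are no $i<j$ with $\pi_j<\pi_{j+1}<\pi_i$. For $\pi\in\mathfrak S_n$ and $j\in\{1,\dots,n+1\}$, appending $j$ to $\pi$ gives the permutation of $\{1,\dots,n+1\}$ whose first $n$ entries are $\pi_i$ if $\pi_i<j$ and $\pi_i+1$ if $\pi_i\ge j$, and whose last entry is $j$. The children of $\pi\in\mathcal C_n$ are the permutations obtained by appending some $j$ to $\pi$ that lie in $\mathcal C_{n+1}$. -}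

module Defs where

open import Data.Nat using (ℕ; zero; suc; _<_; _≤_; _<ᵇ_; _≟_; _<?_; _≤?_)
open import Data.Fin using (Fin; toℕ)
import Data.Fin.Properties as FinP
open import Data.Vec using (Vec; lookup; map; _∷ʳ_)
open import Data.List using (List; upTo)
import Data.List as L
open import Data.Bool using (if_then_else_)
open import Data.Product using (_×_; _,_)
open import Relation.Binary.PropositionalEquality using (_≡_)
open import Relation.Nullary using (¬_; Dec; ¬?; _×-dec_; _→-dec_)

-- A permutation of {1,…,n} in one-line notation: a vector π with
-- π_i = lookup π i (positions indexed by Fin n), such that every
-- entry lies in {1,…,n} and entries are pairwise distinct.
IsPerm : (n : ℕ) → Vec ℕ n → Set
IsPerm n π = ((i : Fin n) → (1 ≤ lookup π i) × (lookup π i ≤ n))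
           × ((i j : Fin n) → lookup π i ≡ lookup π j → i ≡ j)

Avoids1-23 : (n : ℕ) → Vec ℕ n → Set
Avoids1-23 n π = (i j k : Fin n) → toℕ i < toℕ j → toℕ k ≡ suc (toℕ j) →
  ¬ ((lookup π i < lookup π j) × (lookup π j < lookup π k))

Avoids3-12 : (n : ℕ) → Vec ℕ n → Set
Avoids3-12 n π = (i j k : Fin n) → toℕ i < toℕ j → toℕ k ≡ suc (toℕ j) →
  ¬ ((lookup π j < lookup π k) × (lookup π k < lookup π i))

InC : (n : ℕ) → Vec ℕ n → Set
InC n π = IsPerm n π × Avoids1-23 n π × Avoids3-12 n π

InC? : (n : ℕ) → (π : Vec ℕ n) → Dec (InC n π)
InC? n π = perm? ×-dec (a? ×-dec b?)
  where
  perm? = FinP.all? (λ i → (1 ≤? lookup π i) ×-dec (lookup π i ≤? n))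
          ×-dec FinP.all? (λ i → FinP.all? (λ j → (lookup π i ≟ lookup π j) →-dec (i FinP.≟ j)))
  a? = FinP.all? λ i → FinP.all? λ j → FinP.all? λ k →
         (toℕ i <? toℕ j) →-dec ((toℕ k ≟ suc (toℕ j)) →-dec
           ¬? ((lookup π i <? lookup π j) ×-dec (lookup π j <? lookup π k)))
  b? = FinP.all? λ i → FinP.all? λ j → FinP.all? λ k →
         (toℕ i <? toℕ j) →-dec ((toℕ k ≟ suc (toℕ j)) →-dec
           ¬? ((lookup π j <? lookup π k) ×-dec (lookup π k <? lookup π i)))

append : {n : ℕ} → Vec ℕ n → ℕ → Vec ℕ (suc n)
append π j = map (λ x → if x <ᵇ j then x else suc x) π ∷ʳ j

range1 : ℕ → List ℕ
range1 k = L.map suc (upTo k)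

children : (n : ℕ) → Vec ℕ n → List (Vec ℕ (suc n))
children n π = L.filter (InC? (suc n)) (L.map (append π) (range1 (suc n)))

label : (n : ℕ) → Vec ℕ (suc n) → ℕ × ℕ
label n π = (Data.Vec.last π , suc n)

module Submission where

open import Defs
open import Data.Nat using (ℕ; suc; _<_)
open import Data.Vec using (Vec; []; _∷_; last)
open import Data.List using (List; map; _∷_; [])
open import Data.Product using (_×_; _,_)
open import Relation.Binary.PropositionalEquality using (_≡_)
open import Data.List.Relation.Binary.Permutation.Propositional using (_↭_)

open import Data.Nat using (zero; _≤_; z≤n; s≤s; s≤s⁻¹; s<s; _<ᵇ_; _<?_; _≤?_; _≟_)
open import Data.Nat.Properties
  using (<⇒<ᵇ; <ᵇ⇒<; ≤⇒≯; <⇒≢; ≮⇒≥; ≰⇒>; ≤∧≢⇒<; <-cmp; <-irrefl; <-asym; <-trans;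
         ≤-refl; ≤-trans; ≤-antisym; n<1+n; m<n⇒m<1+n; m≤n⇒m≤1+n; suc-injective)
open import Data.Fin using (Fin; toℕ; fromℕ; fromℕ<; inject₁; punchOut)
  renaming (zero to fzero; suc to fsuc)
import Data.Fin.Properties as FinP
open import Data.Vec using (_∷ʳ_; lookup)
import Data.Vec as Vec
import Data.Vec.Properties as VecP
open import Data.List using (filter; _++_; [_]; upTo)
import Data.List.Properties as ListP
open import Data.List.Relation.Unary.All as All using (All; []; _∷_)
import Data.List.Relation.Unary.All.Properties as AllP
open import Data.List.Relation.Binary.Permutation.Propositional using (↭-reflexive)
open import Data.Bool using (true; false; if_then_else_)
open import Data.Unit using (tt)
open import Data.Empty using (⊥-elim)
open import Data.Sum using (_⊎_; inj₁; inj₂)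
open import Data.Product using (Σ; ∃; proj₁; proj₂)
open import Function using (_∘_)
open import Function.Definitions using (Injective)
open import Relation.Nullary using (¬_; yes; no; does; contradiction)
open import Relation.Nullary.Decidable using (_×-dec_; _⊎-dec_)
open import Relation.Unary using (Decidable; _≐_)
open import Relation.Binary.PropositionalEquality
  using (_≢_; refl; sym; trans; cong; cong₂; subst; subst₂; module ≡-Reasoning)
open import Relation.Binary.Definitions using (tri<; tri≈; tri>)

-- Appending j to π keeps the first n entries in the same relative order (they are
-- transformed by the strictly increasing map `shift j`) and puts j last.  Hence
-- append π j is a permutation exactly when 1 ≤ j ≤ n+1, and an occurrence of one of
-- the two patterns in append π j either comes from an occurrence in π or is NEW: it
-- uses the last two positions, i.e. it reads  shift j π_i , shift j π_n , j  for some
-- i < n.  With r = π_n, the children are therefore decided by four cases: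
--   j ≤ r          : shift j r = r+1 > j, so no new occurrence — always a child;
--   r = 1, j = n+1 : no new occurrence either — a child;
--   1 < r < j      : the entry 1 of π lies before r and gives a new 1-23;
--   r = 1 < j ≤ n  : the entry j of π lies before r and gives a new 3-12.
-- The file first develops `shift`, lookups in appended vectors, permutations and the
-- "new occurrence" analysis for an arbitrary order pattern; then it reduces the list of
-- labels of the children to a filter of [1, n+1] and computes the two filters needed.

-- Entries below j stay, the others move up; by definition append π j = map (shift j) π ∷ʳ j.
shift : ℕ → ℕ → ℕ
shift j x = if x <ᵇ j then x else suc x

shift-below : ∀ {j x} → x < j → shift j x ≡ x
shift-below {j} {x} x<j with x <ᵇ j | <⇒<ᵇ x<j
... | true | _ = refl

shift-above : ∀ {j x} → j ≤ x → shift j x ≡ suc x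
shift-above {j} {x} j≤x with x <ᵇ j | <ᵇ⇒< x j
... | false | _ = refl
... | true | x<j = contradiction (x<j tt) (≤⇒≯ j≤x)

shift-cases : ∀ j x → (x < j × shift j x ≡ x) ⊎ (j ≤ x × shift j x ≡ suc x)
shift-cases j x with x <? j
... | yes x<j = inj₁ (x<j , shift-below x<j)
... | no x≮j = inj₂ (≮⇒≥ x≮j , shift-above (≮⇒≥ x≮j))

shift-monotone : ∀ j {x y} → x < y → shift j x < shift j y
shift-monotone j {x} {y} x<y with shift-cases j x | shift-cases j y
... | inj₁ (_ , eqx) | inj₁ (_ , eqy) rewrite eqx | eqy = x<y
... | inj₁ (_ , eqx) | inj₂ (_ , eqy) rewrite eqx | eqy = m<n⇒m<1+n x<y
... | inj₂ (j≤x , _) | inj₁ (y<j , _) = contradiction (<-trans x<y y<j) (≤⇒≯ j≤x)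
... | inj₂ (_ , eqx) | inj₂ (_ , eqy) rewrite eqx | eqy = s<s x<y

shift-reflects-< : ∀ j {x y} → shift j x < shift j y → x < y
shift-reflects-< j {x} {y} sx<sy with <-cmp x y
... | tri< x<y _ _ = x<y
... | tri≈ _ refl _ = contradiction sx<sy (<-irrefl refl)
... | tri> _ _ y<x = contradiction (shift-monotone j y<x) (<-asym sx<sy)

shift-injective : ∀ j {x y} → shift j x ≡ shift j y → x ≡ y
shift-injective j {x} {y} sx≡sy with <-cmp x y
... | tri< x<y _ _ = contradiction sx≡sy (<⇒≢ (shift-monotone j x<y))
... | tri≈ _ x≡y _ = x≡y
... | tri> _ _ y<x = contradiction (sym sx≡sy) (<⇒≢ (shift-monotone j y<x))

shift-≢ : ∀ j x → shift j x ≢ j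
shift-≢ j x sx≡j with shift-cases j x
... | inj₁ (x<j , eq) = <⇒≢ x<j (trans (sym eq) sx≡j)
... | inj₂ (j≤x , eq) = contradiction (subst (_≤ x) (trans (sym sx≡j) eq) j≤x) (<-irrefl refl)

shift-range : ∀ j {x n} → 1 ≤ x → x ≤ n → (1 ≤ shift j x) × (shift j x ≤ suc n)
shift-range j {x} 1≤x x≤n with shift-cases j x
... | inj₁ (_ , eq) rewrite eq = 1≤x , m≤n⇒m≤1+n x≤n
... | inj₂ (_ , eq) rewrite eq = s≤s z≤n , s≤s x≤n

shift-not-below : ∀ {j x} → j ≤ x → ¬ shift j x < j
shift-not-below {j} {x} j≤x sx<j =
  ≤⇒≯ j≤x (<-trans (n<1+n x) (subst (_< j) (shift-above j≤x) sx<j))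

data Position (n : ℕ) (k : Fin (suc n)) : Set where
  before : (i : Fin n) → toℕ k ≡ toℕ i → Position n k
  final  : toℕ k ≡ n → Position n k

before-end : ∀ {n} (k : Fin (suc n)) → toℕ k < n → Σ (Fin n) λ i → toℕ k ≡ toℕ i
before-end k k<n = fromℕ< k<n , sym (FinP.toℕ-fromℕ< k<n)

position : ∀ {n} (k : Fin (suc n)) → Position n k
position {n} k with toℕ k <? n
... | yes k<n = let (i , k≡i) = before-end k k<n in before i k≡i
... | no k≮n = final (≤-antisym (s≤s⁻¹ (FinP.toℕ<n k)) (≮⇒≥ k≮n))

lookup-∷ʳ-before : ∀ {A : Set} {n} (xs : Vec A n) (x : A) (k : Fin (suc n)) (i : Fin n) →
                   toℕ k ≡ toℕ i → lookup (xs ∷ʳ x) k ≡ lookup xs i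
lookup-∷ʳ-before (y ∷ ys) x fzero fzero _ = refl
lookup-∷ʳ-before (y ∷ ys) x (fsuc k) (fsuc i) k≡i = lookup-∷ʳ-before ys x k i (suc-injective k≡i)

lookup-∷ʳ-final : ∀ {A : Set} {n} (xs : Vec A n) (x : A) (k : Fin (suc n)) →
                  toℕ k ≡ n → lookup (xs ∷ʳ x) k ≡ x
lookup-∷ʳ-final [] x fzero _ = refl
lookup-∷ʳ-final (y ∷ ys) x (fsuc k) k≡n = lookup-∷ʳ-final ys x k (suc-injective k≡n)

lookup-last : ∀ {A : Set} {n} (xs : Vec A (suc n)) (k : Fin (suc n)) → toℕ k ≡ n → lookup xs k ≡ last xs
lookup-last (x ∷ []) fzero _ = refl
lookup-last (x ∷ y ∷ ys) (fsuc k) k≡n = lookup-last (y ∷ ys) k (suc-injective k≡n)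

lookup-append-before : ∀ {n} (π : Vec ℕ n) j (k : Fin (suc n)) (i : Fin n) →
                       toℕ k ≡ toℕ i → lookup (append π j) k ≡ shift j (lookup π i)
lookup-append-before π j k i k≡i =
  trans (lookup-∷ʳ-before (Vec.map (shift j) π) j k i k≡i) (VecP.lookup-map i (shift j) π)

lookup-append-final : ∀ {n} (π : Vec ℕ n) j (k : Fin (suc n)) → toℕ k ≡ n → lookup (append π j) k ≡ j
lookup-append-final π j = lookup-∷ʳ-final (Vec.map (shift j) π) j

lookup-append-penultimate : ∀ {m} (π : Vec ℕ (suc m)) j (k : Fin (suc (suc m))) →
                            toℕ k ≡ m → lookup (append π j) k ≡ shift j (last π)
lookup-append-penultimate {m} π j k k≡m =
  trans (lookup-append-before π j k (fromℕ m) (trans k≡m (sym (FinP.toℕ-fromℕ m))))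
        (cong (shift j) (lookup-last π (fromℕ m) (FinP.toℕ-fromℕ m)))

injective⇒surjective : ∀ {n} (f : Fin n → Fin n) → Injective _≡_ _≡_ f → ∀ y → ∃ λ i → f i ≡ y
injective⇒surjective {zero} f _ ()
injective⇒surjective {suc n} f f-injective y with FinP.any? (λ i → f i FinP.≟ y)
... | yes hit = hit
... | no miss = ⊥-elim (FinP.<⇒notInjective {f = g} (n<1+n n) g-injective)
  where
  y-missed : ∀ i → y ≢ f i
  y-missed i y≡fi = miss (i , sym y≡fi)
  g : Fin (suc n) → Fin n
  g i = punchOut (y-missed i)
  g-injective : Injective _≡_ _≡_ g
  g-injective {i} {k} gi≡gk = f-injective (FinP.punchOut-injective (y-missed i) (y-missed k) gi≡gk)

code : ∀ {n} x → 1 ≤ x → x ≤ n → Fin n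
code (suc x) _ x<n = fromℕ< x<n

code-injective : ∀ {n x y} (1≤x : 1 ≤ x) (x≤n : x ≤ n) (1≤y : 1 ≤ y) (y≤n : y ≤ n) →
                 code x 1≤x x≤n ≡ code y 1≤y y≤n → x ≡ y
code-injective {x = suc x} {suc y} _ x<n _ y<n eq = cong suc (FinP.fromℕ<-injective x y x<n y<n eq)

perm-attains : ∀ {n} (π : Vec ℕ n) → IsPerm n π → ∀ v → 1 ≤ v → v ≤ n → ∃ λ i → lookup π i ≡ v
perm-attains {n} π (inRange , injective) v 1≤v v≤n =
  let (i , eq) = injective⇒surjective codeOf codeOf-injective (code v 1≤v v≤n)
  in i , code-injective _ _ _ _ eq
  where
  codeOf : Fin n → Fin n
  codeOf i = code (lookup π i) (proj₁ (inRange i)) (proj₂ (inRange i))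
  codeOf-injective : Injective _≡_ _≡_ codeOf
  codeOf-injective {i} {k} eq = injective i k (code-injective _ _ _ _ eq)

append-perm : ∀ {n} (π : Vec ℕ n) → IsPerm n π → ∀ j → 1 ≤ j → j ≤ suc n → IsPerm (suc n) (append π j)
append-perm {n} π (inRange , injective) j 1≤j j≤n+1 = inRange′ , injective′
  where
  at-before : ∀ k i → toℕ k ≡ toℕ i → lookup (append π j) k ≡ shift j (lookup π i)
  at-before = lookup-append-before π j
  at-final : ∀ k → toℕ k ≡ n → lookup (append π j) k ≡ j
  at-final = lookup-append-final π j

  inRange′ : ∀ k → (1 ≤ lookup (append π j) k) × (lookup (append π j) k ≤ suc n)
  inRange′ k with position k
  ... | before i k≡i rewrite at-before k i k≡i = shift-range j (proj₁ (inRange i)) (proj₂ (inRange i))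
  ... | final k≡n rewrite at-final k k≡n = 1≤j , j≤n+1

  injective′ : ∀ k l → lookup (append π j) k ≡ lookup (append π j) l → k ≡ l
  injective′ k l eq with position k | position l
  ... | before i k≡i | before i′ l≡i′ =
    let πi≡πi′ = shift-injective j (trans (sym (at-before k i k≡i)) (trans eq (at-before l i′ l≡i′)))
    in FinP.toℕ-injective (trans k≡i (trans (cong toℕ (injective i i′ πi≡πi′)) (sym l≡i′)))
  ... | before i k≡i | final l≡n =
    contradiction (trans (sym (at-before k i k≡i)) (trans eq (at-final l l≡n))) (shift-≢ j _)
  ... | final k≡n | before i l≡i =
    contradiction (trans (sym (at-before l i l≡i)) (trans (sym eq) (at-final k k≡n))) (shift-≢ j _)
  ... | final k≡n | final l≡n = FinP.toℕ-injective (trans k≡n (sym l≡n))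

append-perm⇒range : ∀ {n} (π : Vec ℕ n) j → IsPerm (suc n) (append π j) → (1 ≤ j) × (j ≤ suc n)
append-perm⇒range {n} π j (inRange , _) =
  subst (λ v → (1 ≤ v) × (v ≤ suc n)) (lookup-append-final π j (fromℕ n) (FinP.toℕ-fromℕ n))
        (inRange (fromℕ n))

Avoids : (ℕ → ℕ → ℕ → Set) → (n : ℕ) → Vec ℕ n → Set
Avoids R n π = (i j k : Fin n) → toℕ i < toℕ j → toℕ k ≡ suc (toℕ j) →
  ¬ R (lookup π i) (lookup π j) (lookup π k)

-- Avoids1-23 n and Avoids3-12 n are, by definition, Avoids Pattern1-23 n and Avoids Pattern3-12 n.
Pattern1-23 Pattern3-12 : ℕ → ℕ → ℕ → Set
Pattern1-23 a b c = (a < b) × (b < c)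
Pattern3-12 a b c = (b < c) × (c < a)

transport-pattern : ∀ (R : ℕ → ℕ → ℕ → Set) {a a′ b b′ c c′} →
                    a ≡ a′ → b ≡ b′ → c ≡ c′ → R a b c → R a′ b′ c′
transport-pattern R refl refl refl occ = occ

ShiftReflecting : (ℕ → ℕ → ℕ → Set) → Set
ShiftReflecting R = ∀ j {a b c} → R (shift j a) (shift j b) (shift j c) → R a b c

pattern1-23-shift-reflecting : ShiftReflecting Pattern1-23
pattern1-23-shift-reflecting j (a<b , b<c) = shift-reflects-< j a<b , shift-reflects-< j b<c

pattern3-12-shift-reflecting : ShiftReflecting Pattern3-12
pattern3-12-shift-reflecting j (b<c , c<a) = shift-reflects-< j b<c , shift-reflects-< j c<a

-- An occurrence of R in append π j that uses its last two positions.
NewOccurrence : (ℕ → ℕ → ℕ → Set) → ∀ {m} → Vec ℕ (suc m) → ℕ → Set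
NewOccurrence R {m} π j =
  ∃ λ (i : Fin (suc m)) → (toℕ i < m) × R (shift j (lookup π i)) (shift j (last π)) j

append-avoids : ∀ R → ShiftReflecting R → ∀ {m} (π : Vec ℕ (suc m)) j →
  Avoids R (suc m) π → ¬ NewOccurrence R π j → Avoids R (suc (suc m)) (append π j)
append-avoids R reflecting {m} π j avoids no-new i p k i<p k≡p+1 occ with position k
... | before k′ k≡k′ =
  let (p′ , p≡p′) = before-end p p<n
      (i′ , i≡i′) = before-end i (<-trans i<p p<n)
  in avoids i′ p′ k′ (subst₂ _<_ i≡i′ p≡p′ i<p) (trans (sym k≡k′) (trans k≡p+1 (cong suc p≡p′)))
       (reflecting j (transport-pattern R (lookup-append-before π j i i′ i≡i′)
                                          (lookup-append-before π j p p′ p≡p′)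
                                          (lookup-append-before π j k k′ k≡k′) occ))
  where
  p<n : toℕ p < suc m
  p<n = <-trans (subst (toℕ p <_) (sym k≡p+1) (n<1+n (toℕ p)))
                (subst (_< suc m) (sym k≡k′) (FinP.toℕ<n k′))
... | final k≡n =
  let (i′ , i≡i′) = before-end i (<-trans i<m (n<1+n m))
  in no-new (i′ , subst (_< m) i≡i′ i<m , transport-pattern R (lookup-append-before π j i i′ i≡i′)
                                                               (lookup-append-penultimate π j p p≡m)
                                                               (lookup-append-final π j k k≡n) occ)
  where
  p≡m : toℕ p ≡ m
  p≡m = suc-injective (trans (sym k≡p+1) k≡n)
  i<m : toℕ i < m
  i<m = subst (toℕ i <_) p≡m i<p

new-occurrence-forbids : ∀ R {m} (π : Vec ℕ (suc m)) j →
  NewOccurrence R π j → ¬ Avoids R (suc (suc m)) (append π j)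
new-occurrence-forbids R {m} π j (i , i<m , occ) avoids =
  avoids (inject₁ i) penultimate (fromℕ (suc m))
    (subst₂ _<_ (sym (FinP.toℕ-inject₁ i)) (sym penultimate≡m) i<m)
    (trans (FinP.toℕ-fromℕ (suc m)) (cong suc (sym penultimate≡m)))
    (transport-pattern R (sym (lookup-append-before π j (inject₁ i) i (FinP.toℕ-inject₁ i)))
                         (sym (lookup-append-penultimate π j penultimate penultimate≡m))
                         (sym (lookup-append-final π j (fromℕ (suc m)) (FinP.toℕ-fromℕ (suc m)))) occ)
  where
  penultimate : Fin (suc (suc m))
  penultimate = inject₁ (fromℕ m)
  penultimate≡m : toℕ penultimate ≡ m
  penultimate≡m = trans (FinP.toℕ-inject₁ (fromℕ m)) (FinP.toℕ-fromℕ m)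

Interval : ℕ → ℕ → Set
Interval r j = (1 ≤ j) × (j ≤ r)

Interval? : ∀ r → Decidable (Interval r)
Interval? r j = (1 ≤? j) ×-dec (j ≤? r)

Endpoints : ℕ → ℕ → Set
Endpoints n j = (j ≡ 1) ⊎ (j ≡ n)

Endpoints? : ∀ n → Decidable (Endpoints n)
Endpoints? n j = (j ≟ 1) ⊎-dec (j ≟ n)

filter-map : ∀ {A B : Set} {P : B → Set} (P? : Decidable P) (f : A → B) (xs : List A) →
             filter P? (map f xs) ≡ map f (filter (P? ∘ f) xs)
filter-map P? f [] = refl
filter-map P? f (x ∷ xs) with does (P? (f x))
... | true = cong (f x ∷_) (filter-map P? f xs)
... | false = filter-map P? f xs

children-labels : ∀ {n} (π : Vec ℕ n) {Q : ℕ → Set} (Q? : Decidable Q) →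
  (λ j → InC (suc n) (append π j)) ≐ Q →
  map (label n) (children n π) ≡ map (λ j → (j , suc n)) (filter Q? (range1 (suc n)))
children-labels {n} π Q? children≐Q = begin
  map (label n) (filter (InC? (suc n)) (map (append π) js))
    ≡⟨ cong (map (label n)) (filter-map (InC? (suc n)) (append π) js) ⟩
  map (label n) (map (append π) (filter isChild? js))
    ≡⟨ ListP.map-∘ (filter isChild? js) ⟨
  map (label n ∘ append π) (filter isChild? js)
    ≡⟨ ListP.map-cong label-append (filter isChild? js) ⟩
  map (λ j → (j , suc n)) (filter isChild? js)
    ≡⟨ cong (map (λ j → (j , suc n))) (ListP.filter-≐ isChild? Q? children≐Q js) ⟩
  map (λ j → (j , suc n)) (filter Q? js)
    ∎
  where
  open ≡-Reasoning
  js : List ℕ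
  js = range1 (suc n)
  isChild? : Decidable (λ j → InC (suc n) (append π j))
  isChild? = InC? (suc n) ∘ append π
  label-append : ∀ j → label n (append π j) ≡ (j , suc n)
  label-append j = cong (_, suc n) (VecP.last-∷ʳ j (Vec.map (shift j) π))

range1-suc : ∀ k → range1 (suc k) ≡ range1 k ++ [ suc k ]
range1-suc k = trans (cong (map suc) (sym (ListP.upTo-∷ʳ k))) (ListP.map-++ suc (upTo k) [ k ])

range1-bounds : ∀ k → All (Interval k) (range1 k)
range1-bounds zero = []
range1-bounds (suc k) rewrite range1-suc k =
  AllP.++⁺ (All.map (λ (1≤j , j≤k) → 1≤j , m≤n⇒m≤1+n j≤k) (range1-bounds k)) ((s≤s z≤n , ≤-refl) ∷ [])

filter-range1-suc : ∀ {P : ℕ → Set} (P? : Decidable P) k →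
                    filter P? (range1 (suc k)) ≡ filter P? (range1 k) ++ filter P? [ suc k ]
filter-range1-suc P? k = trans (cong (filter P?) (range1-suc k)) (ListP.filter-++ P? (range1 k) [ suc k ])

filter-interval : ∀ {r} k → r ≤ k → filter (Interval? r) (range1 k) ≡ range1 r
filter-interval zero z≤n = refl
filter-interval {r} (suc k) r≤k+1 with r ≟ suc k
... | yes refl = ListP.filter-all (Interval? r) (range1-bounds r)
... | no r≢k+1 = begin
  filter (Interval? r) (range1 (suc k))
    ≡⟨ filter-range1-suc (Interval? r) k ⟩
  filter (Interval? r) (range1 k) ++ filter (Interval? r) [ suc k ]
    ≡⟨ cong₂ _++_ (filter-interval k r≤k) k+1-rejected ⟩
  range1 r ++ []
    ≡⟨ ListP.++-identityʳ (range1 r) ⟩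
  range1 r
    ∎
  where
  open ≡-Reasoning
  r<k+1 : r < suc k
  r<k+1 = ≤∧≢⇒< r≤k+1 r≢k+1
  r≤k : r ≤ k
  r≤k = s≤s⁻¹ r<k+1
  k+1-rejected : filter (Interval? r) [ suc k ] ≡ []
  k+1-rejected = ListP.filter-reject (Interval? r) {xs = []} (λ (_ , k+1≤r) → ≤⇒≯ k+1≤r r<k+1)

filter-endpoints-below : ∀ {n} k → 1 ≤ k → k < n → filter (Endpoints? n) (range1 k) ≡ [ 1 ]
filter-endpoints-below {n} (suc zero) _ _ = ListP.filter-accept (Endpoints? n) {xs = []} (inj₁ refl)
filter-endpoints-below {n} (suc (suc k)) _ k+2<n =
  trans (filter-range1-suc (Endpoints? n) (suc k))
        (cong₂ _++_ (filter-endpoints-below (suc k) (s≤s z≤n) (<-trans (n<1+n _) k+2<n)) k+2-rejected)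
  where
  k+2-rejected : filter (Endpoints? n) [ suc (suc k) ] ≡ []
  k+2-rejected = ListP.filter-reject (Endpoints? n) {xs = []} λ { (inj₁ ()) ; (inj₂ k+2≡n) → <⇒≢ k+2<n k+2≡n }

filter-endpoints : ∀ n → 1 ≤ n → filter (Endpoints? (suc n)) (range1 (suc n)) ≡ 1 ∷ suc n ∷ []
filter-endpoints n 1≤n =
  trans (filter-range1-suc (Endpoints? (suc n)) n)
        (cong₂ _++_ (filter-endpoints-below n 1≤n (n<1+n n))
                    (ListP.filter-accept (Endpoints? (suc n)) {xs = []} (inj₂ refl)))

module Children {m : ℕ} (π : Vec ℕ (suc m)) (π∈C : InC (suc m) π) {r : ℕ} (last≡r : last π ≡ r) where

  π-perm : IsPerm (suc m) π
  π-perm = proj₁ π∈C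

  r-range : (1 ≤ r) × (r ≤ suc m)
  r-range = subst (λ v → (1 ≤ v) × (v ≤ suc m))
                  (trans (lookup-last π (fromℕ m) (FinP.toℕ-fromℕ m)) last≡r) (proj₁ π-perm (fromℕ m))

  occurs-before-last : ∀ v → 1 ≤ v → v ≤ suc m → v ≢ r → ∃ λ i → (toℕ i < m) × (lookup π i ≡ v)
  occurs-before-last v 1≤v v≤n v≢r =
    let (i , πi≡v) = perm-attains π π-perm v 1≤v v≤n
    in i , ≤∧≢⇒< (s≤s⁻¹ (FinP.toℕ<n i)) (i≢m i πi≡v) , πi≡v
    where
    i≢m : ∀ i → lookup π i ≡ v → toℕ i ≢ m
    i≢m i πi≡v i≡m = v≢r (trans (sym πi≡v) (trans (lookup-last π i i≡m) last≡r))

  append-in-C : ∀ j → 1 ≤ j → j ≤ suc (suc m) →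
                ¬ NewOccurrence Pattern1-23 π j → ¬ NewOccurrence Pattern3-12 π j → InC (suc (suc m)) (append π j)
  append-in-C j 1≤j j≤n+1 no-new1-23 no-new3-12 =
    append-perm π π-perm j 1≤j j≤n+1 ,
    append-avoids Pattern1-23 pattern1-23-shift-reflecting π j (proj₁ (proj₂ π∈C)) no-new1-23 ,
    append-avoids Pattern3-12 pattern3-12-shift-reflecting π j (proj₂ (proj₂ π∈C)) no-new3-12

  -- Case j ≤ r: the shifted last entry r+1 exceeds j, which both new occurrences forbid.
  child-up-to-r : ∀ j → 1 ≤ j → j ≤ r → InC (suc (suc m)) (append π j)
  child-up-to-r j 1≤j j≤r =
    append-in-C j 1≤j (m≤n⇒m≤1+n (≤-trans j≤r (proj₂ r-range)))
      (λ (_ , _ , (_ , r′<j)) → shift-not-below j≤last r′<j)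
      (λ (_ , _ , (r′<j , _)) → shift-not-below j≤last r′<j)
    where
    j≤last : j ≤ last π
    j≤last = subst (j ≤_) (sym last≡r) j≤r

  -- Case r = 1, j = m+2: no shifted entry lies below 1 or above m+2.
  child-maximum : r ≡ 1 → InC (suc (suc m)) (append π (suc (suc m)))
  child-maximum r≡1 = append-in-C max (s≤s z≤n) ≤-refl no-new-1-23 no-new-3-12
    where
    max : ℕ
    max = suc (suc m)
    no-new-1-23 : ¬ NewOccurrence Pattern1-23 π max
    no-new-1-23 (i , _ , (πi′<r′ , _)) =
      ≤⇒≯ (proj₁ (proj₁ π-perm i)) (subst (lookup π i <_) (trans last≡r r≡1) (shift-reflects-< max πi′<r′))
    no-new-3-12 : ¬ NewOccurrence Pattern3-12 π max
    no-new-3-12 (i , _ , (_ , max<πi′)) =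
      let (1≤πi , πi≤m+1) = proj₁ π-perm i in ≤⇒≯ (proj₂ (shift-range max 1≤πi πi≤m+1)) max<πi′

  -- Case 1 < r < j: the entry 1 before the end, then r, then j form a 1-23.
  no-child-above-r : 1 < r → ∀ j → r < j → ¬ InC (suc (suc m)) (append π j)
  no-child-above-r 1<r j r<j (_ , avoids1-23 , _) =
    let (i , i<m , πi≡1) = occurs-before-last 1 (s≤s z≤n) (s≤s z≤n) (<⇒≢ 1<r)
    in new-occurrence-forbids Pattern1-23 π j
         (i , i<m , transport-pattern Pattern1-23
                      (sym (trans (cong (shift j) πi≡1) (shift-below (<-trans 1<r r<j))))
                      (sym (trans (cong (shift j) last≡r) (shift-below r<j))) refl (1<r , r<j))
         avoids1-23

  -- Case r = 1 < j ≤ m+1: r = 1, then j, then the entry j before the end (shifted to j+1) form a 3-12.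
  no-middle-child : r ≡ 1 → ∀ j → 1 < j → j ≤ suc m → ¬ InC (suc (suc m)) (append π j)
  no-middle-child r≡1 j 1<j j≤n (_ , _ , avoids3-12) =
    let (i , i<m , πi≡j) = occurs-before-last j (<-trans (s≤s z≤n) 1<j) j≤n
                             (λ j≡r → <⇒≢ 1<j (sym (trans j≡r r≡1)))
    in new-occurrence-forbids Pattern3-12 π j
         (i , i<m , transport-pattern Pattern3-12
                      (sym (trans (cong (shift j) πi≡j) (shift-above ≤-refl)))
                      (sym (trans (cong (shift j) (trans last≡r r≡1)) (shift-below 1<j))) refl (1<j , n<1+n j))
         avoids3-12

  children-when-last-is-1 : r ≡ 1 → (λ j → InC (suc (suc m)) (append π j)) ≐ Endpoints (suc (suc m))
  children-when-last-is-1 r≡1 = to , from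
    where
    to : ∀ {j} → InC (suc (suc m)) (append π j) → Endpoints (suc (suc m)) j
    to {j} child with j ≟ 1 | j ≟ suc (suc m)
    ... | yes j≡1 | _ = inj₁ j≡1
    ... | no _ | yes j≡max = inj₂ j≡max
    ... | no j≢1 | no j≢max =
      let (1≤j , j≤max) = append-perm⇒range π j (proj₁ child)
      in contradiction child
           (no-middle-child r≡1 j (≤∧≢⇒< 1≤j (j≢1 ∘ sym)) (s≤s⁻¹ (≤∧≢⇒< j≤max j≢max)))
    from : ∀ {j} → Endpoints (suc (suc m)) j → InC (suc (suc m)) (append π j)
    from (inj₁ refl) = child-up-to-r 1 ≤-refl (subst (1 ≤_) (sym r≡1) ≤-refl)
    from (inj₂ refl) = child-maximum r≡1

  children-when-last-exceeds-1 : 1 < r → (λ j → InC (suc (suc m)) (append π j)) ≐ Interval r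
  children-when-last-exceeds-1 1<r = to , from
    where
    to : ∀ {j} → InC (suc (suc m)) (append π j) → Interval r j
    to {j} child with j ≤? r
    ... | yes j≤r = proj₁ (append-perm⇒range π j (proj₁ child)) , j≤r
    ... | no j≰r = contradiction child (no-child-above-r 1<r j (≰⇒> j≰r))
    from : ∀ {j} → Interval r j → InC (suc (suc m)) (append π j)
    from {j} (1≤j , j≤r) = child-up-to-r j 1≤j j≤r

  labels-when-last-is-1 : r ≡ 1 →
    map (label (suc m)) (children (suc m) π) ≡ map (λ j → (j , suc (suc m))) (1 ∷ suc (suc m) ∷ [])
  labels-when-last-is-1 r≡1 =
    trans (children-labels π (Endpoints? (suc (suc m))) (children-when-last-is-1 r≡1))
          (cong (map (λ j → (j , suc (suc m)))) (filter-endpoints (suc m) (s≤s z≤n)))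

  labels-when-last-exceeds-1 : 1 < r →
    map (label (suc m)) (children (suc m) π) ≡ map (λ j → (j , suc (suc m))) (range1 r)
  labels-when-last-exceeds-1 1<r =
    trans (children-labels π (Interval? r) (children-when-last-exceeds-1 1<r))
          (cong (map (λ j → (j , suc (suc m))))
                (filter-interval (suc (suc m)) (m≤n⇒m≤1+n (proj₂ r-range))))

one∈C₁ : InC 1 (1 ∷ [])
one∈C₁ = ((λ { fzero → s≤s z≤n , s≤s z≤n }) , (λ { fzero fzero _ → refl }))
       , (λ { fzero fzero _ () }) , (λ { fzero fzero _ () })

lemma3p12 : (InC 1 (1 ∷ []) × label 0 (1 ∷ []) ≡ (1 , 1))
  × ((m : ℕ) → (π : Vec ℕ (suc m)) → InC (suc m) π → (r : ℕ) → label m π ≡ (r , suc m) →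
      (r ≡ 1 → map (label (suc m)) (children (suc m) π) ↭ ((1 , suc (suc m)) ∷ (suc (suc m) , suc (suc m)) ∷ []))
    × (1 < r → map (label (suc m)) (children (suc m) π) ↭ map (λ j → (j , suc (suc m))) (range1 r)))
lemma3p12 = (one∈C₁ , refl) , λ m π π∈C r label≡ →
  let open Children π π∈C (cong proj₁ label≡)
  in ↭-reflexive ∘ labels-when-last-is-1 , ↭-reflexive ∘ labels-when-last-exceeds-1
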